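{- Let $n=2m$ with $m\ge 4$, and let $\Phi$ be the set of equipartitions of $[n]=\{1,\dots,n\}$. Then there is a coloring $c:\Phi\to\{B,R,Y\}$ such that the identity is the only permutation $\sigma\in S_n$ satisfying $c(\sigma(P))=c(P)$ for all $P\in\Phi$, where $S_n$ acts on $\Phi$ via its natural action on $[n]$.
   Context: An equipartition of $[2m]$ is an unordered partition $\{P_1,P_2\}$ of $[2m]$ into two sets with $|P_1|=|P_2|=m$; a permutation $\sigma$ acts by $\sigma(\{P_1,P_2\})=\{\sigma(P_1),\sigma(P_2)\}$. -}

module Defs where

open import Data.Nat using (ℕ; _*_)
open import Data.Product using (_×_)
open import Data.Fin using (Fin)
open import Data.Fin.Subset using (Subset; ∣_∣; _∩_; _∪_; ⊥; ⊤)
open import Data.Fin.Permutation using (Permutation′; _⟨$⟩ʳ_; _⟨$⟩ˡ_)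
open import Data.Vec using (tabulate; lookup)
open import Relation.Binary.PropositionalEquality using (_≡_)

data Colour : Set where
  B R Y : Colour

-- [n] is modelled as Fin n; a subset of [n] is a Subset n.
-- (P₁ , P₂) is an (ordered representative of an) equipartition of [2m]:
-- both parts have m elements, they are disjoint and cover [2m].
IsEquipartition : (m : ℕ) → Subset (2 * m) → Subset (2 * m) → Set
IsEquipartition m P₁ P₂ =
  (∣ P₁ ∣ ≡ m) × (∣ P₂ ∣ ≡ m) × (P₁ ∩ P₂ ≡ ⊥) × (P₁ ∪ P₂ ≡ ⊤)

-- Image of a subset under a permutation: σ(P) = { σ i | i ∈ P },
-- i.e. j ∈ σ(P) iff σ⁻¹ j ∈ P.
image : ∀ {n} → Permutation′ n → Subset n → Subset n
image σ P = tabulate (λ j → lookup P (σ ⟨$⟩ˡ j))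

-- A colouring of the set Φ of (unordered) equipartitions of [2m] is a
-- function on representatives (P₁ , P₂) that does not depend on the order
-- of the two parts (values on non-equipartitions are irrelevant).
record Colouring (m : ℕ) : Set where
  field
    colour    : Subset (2 * m) → Subset (2 * m) → Colour
    unordered : ∀ P₁ P₂ → IsEquipartition m P₁ P₂ → colour P₁ P₂ ≡ colour P₂ P₁

Preserves : ∀ {m} → Colouring m → Permutation′ (2 * m) → Set
Preserves {m} c σ =
  ∀ P₁ P₂ → IsEquipartition m P₁ P₂ →
    Colouring.colour c (image σ P₁) (image σ P₂) ≡ Colouring.colour c P₁ P₂

IsIdentity : ∀ {n} → Permutation′ n → Set
IsIdentity {n} σ = ∀ (i : Fin n) → σ ⟨$⟩ʳ i ≡ i

module Submission where

open import Defs
open import Data.Nat using (ℕ; _≤_; _*_; _+_; _∸_; _<_; _<ᵇ_; z≤n; s≤s; NonZero; >-nonZero)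
import Data.Nat.Properties as ℕ
open import Data.Nat.Properties
  using ( ≤-refl; ≤-trans; ≤-antisym; <-trans; <-≤-trans; ≮⇒≥; <⇒≢; <⇒≱; n≤1+n
        ; n≤0⇒n≡0; m≤m+n; +-identityʳ; +-monoʳ-<; m+n∸m≡n; m+[n∸m]≡n; m<n+o⇒m∸n<o; <⇒<ᵇ; <ᵇ⇒< )
open import Data.Nat.Induction using (<-rec)
open import Data.Bool using (Bool; true; false; not; _xor_; if_then_else_)
open import Data.Bool.Properties using (not-injective; not-involutive; T-≡) renaming (_≟_ to _≟ᵇ_)
open import Data.Empty using (⊥; ⊥-elim)
open import Data.Fin using (Fin; toℕ; fromℕ<)
open import Data.Fin.Properties using (_≟_; toℕ-injective; toℕ<n; toℕ-fromℕ<; any?)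
open import Data.Fin.Permutation using (Permutation′; _⟨$⟩ʳ_; _⟨$⟩ˡ_; inverseˡ; inverseʳ; transpose; flip)
import Data.Fin.Permutation.Components as PC
open import Data.Fin.Subset using (Subset; ∣_∣; ∁)
open import Data.Fin.Subset.Properties using (∣∁p∣≡n∸∣p∣; ∩-inverseʳ; ∪-inverseʳ; ∪-∩-booleanAlgebra)
import Algebra.Lattice.Properties.BooleanAlgebra as BooleanAlgebraProperties
open import Data.Vec using (tabulate; lookup; []; _∷_)
open import Data.Vec.Properties using (lookup∘tabulate; lookup-map; ≡-dec)
open import Data.Vec.Relation.Binary.Pointwise.Extensional using (ext; Pointwise-≡⇒≡)
open import Algebra.Properties.CommutativeMonoid.Sum ℕ.+-0-commutativeMonoid using (sum; sum-permute; sum-cong-≗)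
open import Data.Product using (_×_; _,_; proj₁; proj₂; ∃; ∃₂; Σ)
open import Data.Sum using (_⊎_; inj₁; inj₂)
open import Function using (_∘_; case_of_)
open import Function.Bundles using (_⇔_; mk⇔; Equivalence)
import Function.Properties.Equivalence as ⇔
open import Relation.Nullary using (¬_; Dec; yes; no)
open import Relation.Nullary.Decidable using (_×-dec_; ¬?; dec-true; dec-false; decidable-stable)
open import Relation.Binary.PropositionalEquality

-- Colour Y marks only the partition {L, R} into the halves L = {0, …, m-1} and R = {m, …, 2m-1},
-- so a colour-preserving permutation fixes or exchanges L and R.  Colour R marks the partitions
-- obtained from {L, R} by exchanging a ∈ L with b ∈ R for the edges (a, b) of a bipartite graph on
-- L and R; all others are B.  A colour-preserving permutation therefore induces an automorphism of
-- the graph, or an isomorphism onto its transpose if it exchanges L and R.  The graph is the half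
-- graph r ≤ i with the edge (2, 0) removed: induction on i shows that its only automorphism is the
-- identity, and the top left vertex, adjacent to all of R, has no counterpart in the transpose.

indicator : Bool → ℕ
indicator b = if b then 1 else 0

∣∣≡sum : ∀ {n} (P : Subset n) → ∣ P ∣ ≡ sum (λ j → indicator (lookup P j))
∣∣≡sum []          = refl
∣∣≡sum (true ∷ P)  = cong ℕ.suc (∣∣≡sum P)
∣∣≡sum (false ∷ P) = ∣∣≡sum P

module _ {n : ℕ} where

  subset-ext : {P Q : Subset n} → (∀ j → lookup P j ≡ lookup Q j) → P ≡ Q
  subset-ext P≗Q = Pointwise-≡⇒≡ (ext P≗Q)

  lookup-image : (σ : Permutation′ n) (P : Subset n) (j : Fin n) →
                 lookup (image σ P) j ≡ lookup P (σ ⟨$⟩ˡ j)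
  lookup-image σ P j = lookup∘tabulate _ j

  lookup-∁ : (P : Subset n) (j : Fin n) → lookup (∁ P) j ≡ not (lookup P j)
  lookup-∁ P j = lookup-map j not P

  ∁-involutive : (P : Subset n) → ∁ (∁ P) ≡ P
  ∁-involutive = BooleanAlgebraProperties.¬-involutive (∪-∩-booleanAlgebra n)

  image-∁ : (σ : Permutation′ n) (P : Subset n) → image σ (∁ P) ≡ ∁ (image σ P)
  image-∁ σ P = subset-ext λ j → begin
    lookup (image σ (∁ P)) j   ≡⟨ lookup-image σ (∁ P) j ⟩
    lookup (∁ P) (σ ⟨$⟩ˡ j)     ≡⟨ lookup-∁ P _ ⟩
    not (lookup P (σ ⟨$⟩ˡ j))   ≡⟨ cong not (lookup-image σ P j) ⟨
    not (lookup (image σ P) j) ≡⟨ lookup-∁ (image σ P) j ⟨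
    lookup (∁ (image σ P)) j   ∎
    where open ≡-Reasoning

  ∣image∣ : (σ : Permutation′ n) (P : Subset n) → ∣ image σ P ∣ ≡ ∣ P ∣
  ∣image∣ σ P = begin
    ∣ image σ P ∣                                    ≡⟨ ∣∣≡sum (image σ P) ⟩
    sum (λ j → indicator (lookup (image σ P) j))     ≡⟨ sum-cong-≗ (cong indicator ∘ lookup-image σ P) ⟩
    sum (λ j → indicator (lookup P (σ ⟨$⟩ˡ j)))       ≡⟨ sum-permute (indicator ∘ lookup P) (flip σ) ⟨
    sum (λ j → indicator (lookup P j))               ≡⟨ ∣∣≡sum P ⟨
    ∣ P ∣                                            ∎
    where open ≡-Reasoning

  ⟨$⟩ˡ-injective : (σ : Permutation′ n) {x y : Fin n} → σ ⟨$⟩ˡ x ≡ σ ⟨$⟩ˡ y → x ≡ y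
  ⟨$⟩ˡ-injective σ {x} {y} eq = begin
    x                     ≡⟨ inverseʳ σ ⟨
    σ ⟨$⟩ʳ (σ ⟨$⟩ˡ x)       ≡⟨ cong (σ ⟨$⟩ʳ_) eq ⟩
    σ ⟨$⟩ʳ (σ ⟨$⟩ˡ y)       ≡⟨ inverseʳ σ ⟩
    y                     ∎
    where open ≡-Reasoning

  ⟨$⟩ʳ-injective : (σ : Permutation′ n) {x y : Fin n} → σ ⟨$⟩ʳ x ≡ σ ⟨$⟩ʳ y → x ≡ y
  ⟨$⟩ʳ-injective σ = ⟨$⟩ˡ-injective (flip σ)

equipartition-∁ : ∀ {m} (P : Subset (2 * m)) → ∣ P ∣ ≡ m → IsEquipartition m P (∁ P)
equipartition-∁ {m} P ∣P∣≡m = ∣P∣≡m , ∣∁P∣≡m , ∩-inverseʳ P , ∪-inverseʳ P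
  where
  open ≡-Reasoning
  ∣∁P∣≡m : ∣ ∁ P ∣ ≡ m
  ∣∁P∣≡m = begin
    ∣ ∁ P ∣             ≡⟨ ∣∁p∣≡n∸∣p∣ P ⟩
    2 * m ∸ ∣ P ∣       ≡⟨ cong (2 * m ∸_) ∣P∣≡m ⟩
    m + (m + 0) ∸ m     ≡⟨ m+n∸m≡n m (m + 0) ⟩
    m + 0               ≡⟨ +-identityʳ m ⟩
    m                   ∎

module _ {n : ℕ} where

  transpose-matchˡ : (i j : Fin n) → PC.transpose i j i ≡ j
  transpose-matchˡ i j rewrite dec-true (i ≟ i) refl = refl

  transpose-matchʳ : (i j : Fin n) → PC.transpose i j j ≡ i
  transpose-matchʳ i j with j ≟ i
  ... | yes j≡i = j≡i
  ... | no _ rewrite dec-true (j ≟ j) refl = refl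

  transpose-mismatch : {i j k : Fin n} → k ≢ i → k ≢ j → PC.transpose i j k ≡ k
  transpose-mismatch {i} {j} {k} k≢i k≢j
    rewrite dec-false (k ≟ i) k≢i | dec-false (k ≟ j) k≢j = refl

  transpose-comm : (i j k : Fin n) → PC.transpose i j k ≡ PC.transpose j i k
  transpose-comm i j k = by-cases (k ≟ i) (k ≟ j)
    where
    by-cases : Dec (k ≡ i) → Dec (k ≡ j) → PC.transpose i j k ≡ PC.transpose j i k
    by-cases (yes refl) _ = trans (transpose-matchˡ k j) (sym (transpose-matchʳ j k))
    by-cases (no _) (yes refl) = trans (transpose-matchʳ i k) (sym (transpose-matchˡ k i))
    by-cases (no k≢i) (no k≢j) =
      trans (transpose-mismatch k≢i k≢j) (sym (transpose-mismatch k≢j k≢i))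

  transpose-natural : (f : Fin n → Fin n) → (∀ {x y} → f x ≡ f y → x ≡ y) → (i j k : Fin n) →
                      PC.transpose (f i) (f j) (f k) ≡ f (PC.transpose i j k)
  transpose-natural f f-injective i j k = by-cases (k ≟ i) (k ≟ j)
    where
    by-cases : Dec (k ≡ i) → Dec (k ≡ j) → PC.transpose (f i) (f j) (f k) ≡ f (PC.transpose i j k)
    by-cases (yes refl) _ =
      trans (transpose-matchˡ (f k) (f j)) (cong f (sym (transpose-matchˡ k j)))
    by-cases (no _) (yes refl) =
      trans (transpose-matchʳ (f i) (f k)) (cong f (sym (transpose-matchʳ i k)))
    by-cases (no k≢i) (no k≢j) =
      trans (transpose-mismatch (k≢i ∘ f-injective) (k≢j ∘ f-injective))
            (cong f (sym (transpose-mismatch k≢i k≢j)))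

  image-transpose-comm : (a b : Fin n) (P : Subset n) →
                         image (transpose a b) P ≡ image (transpose b a) P
  image-transpose-comm a b P = subset-ext λ j →
    trans (lookup-image (transpose a b) P j)
          (trans (cong (lookup P) (transpose-comm b a j)) (sym (lookup-image (transpose b a) P j)))

  -- σ τ_ab σ⁻¹ = τ_(σa)(σb)
  image-transpose : (σ : Permutation′ n) (a b : Fin n) (P : Subset n) →
    image σ (image (transpose a b) P) ≡ image (transpose (σ ⟨$⟩ʳ a) (σ ⟨$⟩ʳ b)) (image σ P)
  image-transpose σ a b P = subset-ext λ y → begin
    lookup (image σ (image (transpose a b) P)) y       ≡⟨ lookup-image σ (image (transpose a b) P) y ⟩
    lookup (image (transpose a b) P) (σ ⟨$⟩ˡ y)        ≡⟨ lookup-image (transpose a b) P _ ⟩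
    lookup P (PC.transpose b a (σ ⟨$⟩ˡ y))             ≡⟨ cong (lookup P) (conjugate y) ⟩
    lookup P (σ ⟨$⟩ˡ PC.transpose σb σa y)             ≡⟨ lookup-image σ P _ ⟨
    lookup (image σ P) (PC.transpose σb σa y)          ≡⟨ lookup-image (transpose σa σb) (image σ P) y ⟨
    lookup (image (transpose σa σb) (image σ P)) y     ∎
    where
    open ≡-Reasoning
    σa σb : Fin n
    σa = σ ⟨$⟩ʳ a
    σb = σ ⟨$⟩ʳ b
    conjugate : ∀ y → PC.transpose b a (σ ⟨$⟩ˡ y) ≡ σ ⟨$⟩ˡ PC.transpose σb σa y
    conjugate y =
      trans (cong₂ (λ u v → PC.transpose u v (σ ⟨$⟩ˡ y)) (sym (inverseˡ σ)) (sym (inverseˡ σ)))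
            (transpose-natural (σ ⟨$⟩ˡ_) (⟨$⟩ˡ-injective σ) σb σa y)

-- The graph

-- The half graph without the edge (2, 0); removing that one edge is what makes it rigid.
Adj : ℕ → ℕ → Set
Adj i r = r ≤ i × ¬ (i ≡ 2 × r ≡ 0)

Adj? : ∀ i r → Dec (Adj i r)
Adj? i r = (r ℕ.≤? i) ×-dec ¬? ((i ℕ.≟ 2) ×-dec (r ℕ.≟ 0))

Adj-refl : ∀ i → Adj i i
Adj-refl i = ≤-refl , λ { (refl , ()) }

¬Adj⇒exception : ∀ {i r} → r ≤ i → ¬ Adj i r → i ≡ 2 × r ≡ 0
¬Adj⇒exception {i} {r} r≤i ¬adj =
  decidable-stable ((i ℕ.≟ 2) ×-dec (r ℕ.≟ 0)) (λ ¬exception → ¬adj (r≤i , ¬exception))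

record IsBijectionBelow (m : ℕ) (f : ℕ → ℕ) : Set where
  field
    maps-into  : ∀ {k} → k < m → f k < m
    injective  : ∀ {j k} → j < m → k < m → f j ≡ f k → j ≡ k
    surjective : ∀ {k} → k < m → ∃ λ j → j < m × f j ≡ k

fixed-below⇒≤ : ∀ {m h k} → IsBijectionBelow m h → (∀ {j} → j < k → h j ≡ j) → k < m → k ≤ h k
fixed-below⇒≤ h-bij fixed k<m = ≮⇒≥ λ hk<k →
  <⇒≢ hk<k (IsBijectionBelow.injective h-bij (<-trans hk<k k<m) k<m (fixed hk<k))

preimage-fixed-below⇒≤ : ∀ {k i} (h : ℕ → ℕ) → (∀ {j} → j < k → h j ≡ j) → h i ≡ k → k ≤ i
preimage-fixed-below⇒≤ h fixed hi≡k = ≮⇒≥ λ i<k → <⇒≢ i<k (trans (sym (fixed i<k)) hi≡k)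

module _ {m : ℕ} (3≤m : 3 ≤ m) {f g : ℕ → ℕ}
         (f-bij : IsBijectionBelow m f) (g-bij : IsBijectionBelow m g)
         (adj⇔ : ∀ {i r} → i < m → r < m → Adj i r ⇔ Adj (f i) (g r)) where

  private
    module F = IsBijectionBelow f-bij
    module G = IsBijectionBelow g-bij

    1<m : 1 < m
    1<m = ≤-trans (n≤1+n 2) 3≤m

    adjacent-images : ∀ {i r} → i < m → r < m → Adj i r → g r ≤ f i
    adjacent-images i<m r<m adj = proj₁ (Equivalence.to (adj⇔ i<m r<m) adj)

    -- Right vertices 1 and 2 are both adjacent to left vertex 2.
    f2≢0 : f 2 ≢ 0
    f2≢0 f2≡0 = case G.injective 1<m 3≤m g1≡g2 of λ ()
      where
      g≡0 : ∀ {r} → r < m → Adj 2 r → g r ≡ 0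
      g≡0 r<m adj = n≤0⇒n≡0 (subst (g _ ≤_) f2≡0 (adjacent-images 3≤m r<m adj))
      g1≡g2 : g 1 ≡ g 2
      g1≡g2 = trans (g≡0 1<m (s≤s z≤n , λ { (_ , ()) })) (sym (g≡0 3≤m (Adj-refl 2)))

    fixed-next : ∀ {k} → k < m → (∀ {j} → j < k → f j ≡ j × g j ≡ j) → f k ≡ k × g k ≡ k
    fixed-next {k} k<m fixed = trans fk≡gk gk≡k , gk≡k
      where
      -- g r = f k forces Adj k r, so r ≤ k; r < k is excluded by injectivity of f.
      fk≡gk : f k ≡ g k
      fk≡gk with G.surjective (F.maps-into k<m)
      ... | r , r<m , gr≡fk = trans (sym gr≡fk) (cong g r≡k)
        where
        r≤k : r ≤ k
        r≤k = proj₁ (Equivalence.from (adj⇔ k<m r<m) (subst (Adj (f k)) (sym gr≡fk) (Adj-refl (f k))))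
        r≡k : r ≡ k
        r≡k = ≤-antisym r≤k (≮⇒≥ λ r<k →
          <⇒≢ r<k (F.injective (<-trans r<k k<m) k<m
            (trans (proj₁ (fixed r<k)) (trans (sym (proj₂ (fixed r<k))) gr≡fk))))
      -- f i = k forces k ≤ i, so (i, k) is an edge unless it is (2, 0).
      gk≤k : g k ≤ k
      gk≤k with F.surjective k<m
      ... | i , i<m , fi≡k with Adj? i k
      ...   | yes adj = subst (g k ≤_) fi≡k (adjacent-images i<m k<m adj)
      ...   | no ¬adj with ¬Adj⇒exception (preimage-fixed-below⇒≤ f (proj₁ ∘ fixed) fi≡k) ¬adj
      ...     | refl , refl = ⊥-elim (f2≢0 fi≡k)
      gk≡k : g k ≡ k
      gk≡k = ≤-antisym gk≤k (fixed-below⇒≤ g-bij (proj₂ ∘ fixed) k<m)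

  adj-rigid : ∀ k → k < m → f k ≡ k × g k ≡ k
  adj-rigid = <-rec _ λ k rec k<m → fixed-next k<m λ j<k → rec j<k (<-trans j<k k<m)

no-adj-reversal : ∀ {m} {f g : ℕ → ℕ} → 4 ≤ m → IsBijectionBelow m g →
                  ¬ (∀ {i r} → i < m → r < m → Adj i r → Adj (g r) (f i))
no-adj-reversal {ℕ.suc t} {f} {g} (s≤s 3≤t) g-bij reverses
  with IsBijectionBelow.surjective g-bij {0} (s≤s z≤n)
     | IsBijectionBelow.surjective g-bij {2} (s≤s (≤-trans (n≤1+n 2) 3≤t))
... | r₀ , r₀<m , gr₀≡0 | r₂ , r₂<m , gr₂≡2 = proj₂ (top-adjacent r₂<m) (gr₂≡2 , ft≡0)
  where
  top-adjacent : ∀ {r} → r < ℕ.suc t → Adj (g r) (f t)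
  top-adjacent r<m = reverses ≤-refl r<m (ℕ.≤-pred r<m , λ (t≡2 , _) → <⇒≢ 3≤t (sym t≡2))
  ft≡0 : f t ≡ 0
  ft≡0 = n≤0⇒n≡0 (subst (f t ≤_) gr₀≡0 (proj₁ (top-adjacent r₀<m)))

-- The colouring

_⊔_ : Colour → Colour → Colour
Y ⊔ _ = Y
R ⊔ Y = Y
R ⊔ _ = R
B ⊔ c = c

⊔-comm : ∀ c d → c ⊔ d ≡ d ⊔ c
⊔-comm B B = refl
⊔-comm B R = refl
⊔-comm B Y = refl
⊔-comm R B = refl
⊔-comm R R = refl
⊔-comm R Y = refl
⊔-comm Y B = refl
⊔-comm Y R = refl
⊔-comm Y Y = refl

⊔-identityʳ : ∀ c → c ⊔ B ≡ c
⊔-identityʳ B = refl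
⊔-identityʳ R = refl
⊔-identityʳ Y = refl

⊔≡Y : ∀ {c d} → c ⊔ d ≡ Y → c ≡ Y ⊎ d ≡ Y
⊔≡Y {Y}     _ = inj₁ refl
⊔≡Y {d = Y} _ = inj₂ refl
⊔≡Y {R} {R} ()
⊔≡Y {R} {B} ()
⊔≡Y {B} {R} ()
⊔≡Y {B} {B} ()

<⇒<ᵇ≡true : ∀ {k m} → k < m → (k <ᵇ m) ≡ true
<⇒<ᵇ≡true k<m = Equivalence.to T-≡ (<⇒<ᵇ k<m)

<ᵇ≡true⇒< : ∀ {k m} → (k <ᵇ m) ≡ true → k < m
<ᵇ≡true⇒< {k} {m} eq = <ᵇ⇒< k m (Equivalence.from T-≡ eq)

<ᵇ≡false⇒≥ : ∀ {k m} → (k <ᵇ m) ≡ false → m ≤ k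
<ᵇ≡false⇒≥ eq = ≮⇒≥ λ k<m → case trans (sym (<⇒<ᵇ≡true k<m)) eq of λ ()

≥⇒<ᵇ≡false : ∀ {k m} → m ≤ k → (k <ᵇ m) ≡ false
≥⇒<ᵇ≡false {k} {m} m≤k with k <ᵇ m in k<m?
... | false = refl
... | true  = ⊥-elim (<⇒≱ (<ᵇ≡true⇒< k<m?) m≤k)

∣tabulate-<ᵇ∣ : ∀ a b → ∣ tabulate {n = a + b} (λ x → toℕ x <ᵇ a) ∣ ≡ a
∣tabulate-<ᵇ∣ ℕ.zero    b = ∣all-false∣ b
  where
  ∣all-false∣ : ∀ b → ∣ tabulate {n = b} (λ _ → false) ∣ ≡ 0
  ∣all-false∣ ℕ.zero    = refl
  ∣all-false∣ (ℕ.suc b) = ∣all-false∣ b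
∣tabulate-<ᵇ∣ (ℕ.suc a) b = cong ℕ.suc (∣tabulate-<ᵇ∣ a b)

separated-by : ∀ {n} {P Q : Subset n} x → lookup P x ≡ true → lookup Q x ≡ false → P ≢ Q
separated-by x Px Qx refl = case trans (sym Px) Qx of λ ()

positive-below-3-avoiding : (w : ℕ) → ∃ λ k → k < 3 × k ≢ 0 × k ≢ w
positive-below-3-avoiding w with w ℕ.≟ 1
... | yes refl = 2 , ≤-refl , (λ ()) , (λ ())
... | no w≢1   = 1 , s≤s (s≤s z≤n) , (λ ()) , w≢1 ∘ sym

below-3-avoiding : (u v : ℕ) → ∃ λ k → k < 3 × k ≢ u × k ≢ v
below-3-avoiding u v with u ℕ.≟ 0 | v ℕ.≟ 0
... | no u≢0   | no v≢0   = 0 , s≤s z≤n , u≢0 ∘ sym , v≢0 ∘ sym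
... | yes refl | _        = positive-below-3-avoiding v
... | no _     | yes refl with positive-below-3-avoiding u
...   | k , k<3 , k≢0 , k≢u = k , k<3 , k≢u , k≢0

module Construction (m : ℕ) where

  n : ℕ
  n = 2 * m

  isLeft : Fin n → Bool
  isLeft x = toℕ x <ᵇ m

  Half : Subset n
  Half = tabulate isLeft

  offset : Bool → ℕ
  offset true  = 0
  offset false = m

  coord : Fin n → ℕ
  coord x = toℕ x ∸ offset (isLeft x)

  Edge : Fin n → Fin n → Set
  Edge a b = isLeft a ≡ true × isLeft b ≡ false × Adj (coord a) (coord b)

  Edge? : ∀ a b → Dec (Edge a b)
  Edge? a b = (isLeft a ≟ᵇ true) ×-dec (isLeft b ≟ᵇ false) ×-dec Adj? (coord a) (coord b)

  swapped : Fin n → Fin n → Subset n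
  swapped a b = image (transpose a b) Half

  Red : Subset n → Set
  Red P = ∃₂ λ a b → Edge a b × P ≡ swapped a b

  _≟ˢ_ : (P Q : Subset n) → Dec (P ≡ Q)
  _≟ˢ_ = ≡-dec _≟ᵇ_

  Red? : ∀ P → Dec (Red P)
  Red? P = any? λ a → any? λ b → Edge? a b ×-dec P ≟ˢ swapped a b

  shade : Subset n → Colour
  shade P with P ≟ˢ Half | Red? P
  ... | yes _ | _     = Y
  ... | no _  | yes _ = R
  ... | no _  | no _  = B

  pairColour : Subset n → Subset n → Colour
  pairColour P Q = shade P ⊔ shade Q

  colouring : Colouring m
  colouring = record { colour = pairColour ; unordered = λ P Q _ → ⊔-comm (shade P) (shade Q) }

  shade-Half : shade Half ≡ Y
  shade-Half with Half ≟ˢ Half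
  ... | yes _        = refl
  ... | no Half≢Half = ⊥-elim (Half≢Half refl)

  shade≡Y⇒≡Half : ∀ {P} → shade P ≡ Y → P ≡ Half
  shade≡Y⇒≡Half {P} shade≡Y with P ≟ˢ Half | Red? P
  ... | yes P≡Half | _     = P≡Half
  ... | no _       | yes _ = case shade≡Y of λ ()
  ... | no _       | no _  = case shade≡Y of λ ()

  shade≡R⇒Red : ∀ {P} → shade P ≡ R → Red P
  shade≡R⇒Red {P} shade≡R with P ≟ˢ Half | Red? P
  ... | yes _ | _       = case shade≡R of λ ()
  ... | no _  | yes red = red
  ... | no _  | no _    = case shade≡R of λ ()

  shade-Red : ∀ {P} → P ≢ Half → Red P → shade P ≡ R
  shade-Red {P} P≢Half red with P ≟ˢ Half | Red? P
  ... | yes P≡Half | _      = ⊥-elim (P≢Half P≡Half)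
  ... | no _       | yes _  = refl
  ... | no _       | no ¬red = ⊥-elim (¬red red)

  shade-¬Red : ∀ {P} → P ≢ Half → ¬ Red P → shade P ≡ B
  shade-¬Red {P} P≢Half ¬red with P ≟ˢ Half | Red? P
  ... | yes P≡Half | _     = ⊥-elim (P≢Half P≡Half)
  ... | no _       | yes red = ⊥-elim (¬red red)
  ... | no _       | no _  = refl

  ∣Half∣ : ∣ Half ∣ ≡ m
  ∣Half∣ = ∣tabulate-<ᵇ∣ m (m + 0)

  lookup-Half : ∀ x → lookup Half x ≡ isLeft x
  lookup-Half = lookup∘tabulate isLeft

  ∣swapped∣ : ∀ a b → ∣ swapped a b ∣ ≡ m
  ∣swapped∣ a b = trans (∣image∣ (transpose a b) Half) ∣Half∣

  swapped-comm : ∀ a b → swapped a b ≡ swapped b a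
  swapped-comm a b = image-transpose-comm a b Half

  swapped-at-left : ∀ a b → lookup (swapped a b) a ≡ isLeft b
  swapped-at-left a b = trans (lookup-image (transpose a b) Half a)
    (trans (cong (lookup Half) (transpose-matchʳ b a)) (lookup-Half b))

  swapped-at-right : ∀ a b → lookup (swapped a b) b ≡ isLeft a
  swapped-at-right a b = trans (lookup-image (transpose a b) Half b)
    (trans (cong (lookup Half) (transpose-matchˡ b a)) (lookup-Half a))

  swapped-elsewhere : ∀ {a b x} → x ≢ a → x ≢ b → lookup (swapped a b) x ≡ isLeft x
  swapped-elsewhere {a} {b} {x} x≢a x≢b = trans (lookup-image (transpose a b) Half x)
    (trans (cong (lookup Half) (transpose-mismatch x≢b x≢a)) (lookup-Half x))

  left≢right : ∀ {a b} → isLeft a ≡ true → isLeft b ≡ false → a ≢ b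
  left≢right la rb refl = case trans (sym la) rb of λ ()

  left-avoiding : 3 ≤ m → (a c : Fin n) → ∃ λ x → isLeft x ≡ true × x ≢ a × x ≢ c
  left-avoiding 3≤m a c with below-3-avoiding (toℕ a) (toℕ c)
  ... | k , k<3 , k≢a , k≢c =
    x , trans (cong (_<ᵇ m) toℕx≡k) (<⇒<ᵇ≡true k<m) , k≢a ∘ k≡toℕ , k≢c ∘ k≡toℕ
    where
    k<m : k < m
    k<m = <-≤-trans k<3 3≤m
    k<n : k < n
    k<n = <-≤-trans k<m (m≤m+n m (m + 0))
    x : Fin n
    x = fromℕ< k<n
    toℕx≡k : toℕ x ≡ k
    toℕx≡k = toℕ-fromℕ< k<n
    k≡toℕ : ∀ {y} → x ≡ y → k ≡ toℕ y
    k≡toℕ x≡y = trans (sym toℕx≡k) (cong toℕ x≡y)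

  swapped-injective : ∀ {a b c d} → isLeft a ≡ true → isLeft b ≡ false →
                      isLeft c ≡ true → isLeft d ≡ false →
                      swapped a b ≡ swapped c d → a ≡ c × b ≡ d
  swapped-injective {a} {b} {c} {d} la rb lc rd eq = a≡c , b≡d
    where
    a≡c : a ≡ c
    a≡c = decidable-stable (a ≟ c) λ a≢c →
      separated-by a (trans (swapped-elsewhere a≢c (left≢right la rd)) la)
                     (trans (swapped-at-left a b) rb) (sym eq)
    b≡d : b ≡ d
    b≡d = decidable-stable (b ≟ d) λ b≢d →
      separated-by b (trans (swapped-at-right a b) la)
                     (trans (swapped-elsewhere (left≢right lc rb ∘ sym) b≢d) rb) eq

  swapped≢Half : ∀ {a b} → isLeft a ≡ true → isLeft b ≡ false → swapped a b ≢ Half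
  swapped≢Half {a} {b} la rb =
    ≢-sym (separated-by a (trans (lookup-Half a) la) (trans (swapped-at-left a b) rb))

  ∁swapped≢Half : 3 ≤ m → ∀ {a b} → isLeft a ≡ true → isLeft b ≡ false → ∁ (swapped a b) ≢ Half
  ∁swapped≢Half 3≤m {a} {b} la rb with left-avoiding 3≤m a a
  ... | x , lx , x≢a , _ = ≢-sym (separated-by x (trans (lookup-Half x) lx)
    (trans (lookup-∁ (swapped a b) x) (cong not (trans (swapped-elsewhere x≢a (left≢right lx rb)) lx))))

  swapped≢∁swapped : 3 ≤ m → ∀ {a b c d} → isLeft a ≡ true → isLeft b ≡ false →
                     isLeft c ≡ true → isLeft d ≡ false → swapped a b ≢ ∁ (swapped c d)
  swapped≢∁swapped 3≤m {a} {b} {c} {d} la rb lc rd with left-avoiding 3≤m a c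
  ... | x , lx , x≢a , x≢c = separated-by x (trans (swapped-elsewhere x≢a (left≢right lx rb)) lx)
    (trans (lookup-∁ (swapped c d) x) (cong not (trans (swapped-elsewhere x≢c (left≢right lx rd)) lx)))

  Edge⇔red : 3 ≤ m → ∀ {a b} → isLeft a ≡ true → isLeft b ≡ false →
             Edge a b ⇔ pairColour (swapped a b) (∁ (swapped a b)) ≡ R
  Edge⇔red 3≤m {a} {b} la rb = mk⇔ to from
    where
    shade-∁swapped : shade (∁ (swapped a b)) ≡ B
    shade-∁swapped = shade-¬Red (∁swapped≢Half 3≤m la rb)
      λ (c , d , (lc , rd , _) , eq) → swapped≢∁swapped 3≤m lc rd la rb (sym eq)
    to : Edge a b → pairColour (swapped a b) (∁ (swapped a b)) ≡ R
    to e = cong₂ _⊔_ (shade-Red (swapped≢Half la rb) (a , b , e , refl)) shade-∁swapped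
    from : pairColour (swapped a b) (∁ (swapped a b)) ≡ R → Edge a b
    from red
      with shade≡R⇒Red (trans (sym (trans (cong (shade (swapped a b) ⊔_) shade-∁swapped) (⊔-identityʳ _))) red)
    ... | c , d , e@(lc , rd , _) , eq with swapped-injective la rb lc rd eq
    ...   | refl , refl = e

  Edge⇔Adj : ∀ {x y} → isLeft x ≡ true → isLeft y ≡ false → Edge x y ⇔ Adj (coord x) (coord y)
  Edge⇔Adj lx ry = mk⇔ (proj₂ ∘ proj₂) (λ adj → lx , ry , adj)

xor-cancelˡ : ∀ b {s t} → b xor s ≡ b xor t → s ≡ t
xor-cancelˡ false eq = eq
xor-cancelˡ true  eq = not-injective eq

module Coordinates {m : ℕ} (0<m : 0 < m) where

  open Construction m

  private
    instance
      m-nonZero : NonZero m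
      m-nonZero = >-nonZero 0<m

    m≤n : m ≤ n
    m≤n = m≤m+n m (m + 0)

    toℕ<m+m : (x : Fin n) → toℕ x < m + m
    toℕ<m+m x = subst (toℕ x <_) (cong (m +_) (+-identityʳ m)) (toℕ<n x)

    -- Junk value 0 outside [0, n).
    toFin : ℕ → Fin n
    toFin k with k ℕ.<? n
    ... | yes k<n = fromℕ< k<n
    ... | no _    = fromℕ< (<-≤-trans 0<m m≤n)

    toℕ-toFin : ∀ {k} → k < n → toℕ (toFin k) ≡ k
    toℕ-toFin {k} k<n with k ℕ.<? n
    ... | yes k<n′ = toℕ-fromℕ< k<n′
    ... | no k≮n   = ⊥-elim (k≮n k<n)

    offset+<n : ∀ s {k} → k < m → offset s + k < n
    offset+<n true  k<m = <-≤-trans k<m m≤n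
    offset+<n false k<m = +-monoʳ-< m (subst (_ <_) (sym (+-identityʳ m)) k<m)

  offset+coord : ∀ x → offset (isLeft x) + coord x ≡ toℕ x
  offset+coord x with isLeft x in left?
  ... | true  = refl
  ... | false = m+[n∸m]≡n (<ᵇ≡false⇒≥ {m = m} left?)

  coord<m : ∀ x → coord x < m
  coord<m x with isLeft x in left?
  ... | true  = <ᵇ≡true⇒< left?
  ... | false = m<n+o⇒m∸n<o (toℕ x) m (toℕ<m+m x)

  vertex : Bool → ℕ → Fin n
  vertex s k = toFin (offset s + k)

  toℕ-vertex : ∀ {s k} → k < m → toℕ (vertex s k) ≡ offset s + k
  toℕ-vertex {s} k<m = toℕ-toFin (offset+<n s k<m)

  isLeft-vertex : ∀ {s k} → k < m → isLeft (vertex s k) ≡ s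
  isLeft-vertex {s} {k} k<m = trans (cong (_<ᵇ m) (toℕ-vertex k<m)) (side s)
    where
    side : ∀ s → (offset s + k <ᵇ m) ≡ s
    side true  = <⇒<ᵇ≡true k<m
    side false = ≥⇒<ᵇ≡false (m≤m+n m k)

  coord-vertex : ∀ {s k} → k < m → coord (vertex s k) ≡ k
  coord-vertex {s} {k} k<m = begin
    toℕ (vertex s k) ∸ offset (isLeft (vertex s k))
      ≡⟨ cong₂ _∸_ (toℕ-vertex k<m) (cong offset (isLeft-vertex k<m)) ⟩
    offset s + k ∸ offset s                         ≡⟨ m+n∸m≡n (offset s) k ⟩
    k                                               ∎
    where open ≡-Reasoning

  vertex-coord : ∀ x → vertex (isLeft x) (coord x) ≡ x
  vertex-coord x = toℕ-injective (trans (cong (toℕ ∘ toFin) (offset+coord x)) (toℕ-toFin (toℕ<n x)))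

  coord-injective : ∀ {x y} → isLeft x ≡ isLeft y → coord x ≡ coord y → x ≡ y
  coord-injective {x} {y} same-side same-coord = begin
    x                                ≡⟨ vertex-coord x ⟨
    vertex (isLeft x) (coord x)      ≡⟨ cong₂ vertex same-side same-coord ⟩
    vertex (isLeft y) (coord y)      ≡⟨ vertex-coord y ⟩
    y                                ∎
    where open ≡-Reasoning

  Adj⇔Edge-vertex : ∀ {i r} → i < m → r < m → Adj i r ⇔ Edge (vertex true i) (vertex false r)
  Adj⇔Edge-vertex {i} {r} i<m r<m =
    ⇔.sym (subst₂ (λ i′ r′ → Edge (vertex true i) (vertex false r) ⇔ Adj i′ r′)
                  (coord-vertex i<m) (coord-vertex r<m)
                  (Edge⇔Adj (isLeft-vertex i<m) (isLeft-vertex r<m)))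

  induced : Permutation′ n → Bool → ℕ → ℕ
  induced π s k = coord (π ⟨$⟩ʳ vertex s k)

  induced-bijection : (π : Permutation′ n) (b : Bool) → (∀ x → isLeft (π ⟨$⟩ʳ x) ≡ b xor isLeft x) →
                      ∀ s → IsBijectionBelow m (induced π s)
  induced-bijection π b sides s = record
    { maps-into  = λ _ → coord<m _
    ; injective  = injective
    ; surjective = surjective
    }
    where
    open ≡-Reasoning
    side-of-image : ∀ {k} → k < m → isLeft (π ⟨$⟩ʳ vertex s k) ≡ b xor s
    side-of-image k<m = trans (sides _) (cong (b xor_) (isLeft-vertex k<m))
    injective : ∀ {j k} → j < m → k < m → induced π s j ≡ induced π s k → j ≡ k
    injective {j} {k} j<m k<m eq = begin
      j                     ≡⟨ coord-vertex j<m ⟨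
      coord (vertex s j)    ≡⟨ cong coord (⟨$⟩ʳ-injective π
                                 (coord-injective (trans (side-of-image j<m) (sym (side-of-image k<m))) eq)) ⟩
      coord (vertex s k)    ≡⟨ coord-vertex k<m ⟩
      k                     ∎
    surjective : ∀ {k} → k < m → ∃ λ j → j < m × induced π s j ≡ k
    surjective {k} k<m = coord y , coord<m y , (begin
      coord (π ⟨$⟩ʳ vertex s (coord y))           ≡⟨ cong (λ t → coord (π ⟨$⟩ʳ vertex t (coord y))) y-side ⟨
      coord (π ⟨$⟩ʳ vertex (isLeft y) (coord y))  ≡⟨ cong (λ z → coord (π ⟨$⟩ʳ z)) (vertex-coord y) ⟩
      coord (π ⟨$⟩ʳ y)                            ≡⟨ cong coord (inverseʳ π) ⟩
      coord (vertex (b xor s) k)                  ≡⟨ coord-vertex k<m ⟩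
      k                                           ∎)
      where
      y : Fin n
      y = π ⟨$⟩ˡ vertex (b xor s) k
      y-side : isLeft y ≡ s
      y-side = xor-cancelˡ b (begin
        b xor isLeft y                ≡⟨ sides y ⟨
        isLeft (π ⟨$⟩ʳ y)             ≡⟨ cong isLeft (inverseʳ π) ⟩
        isLeft (vertex (b xor s) k)   ≡⟨ isLeft-vertex k<m ⟩
        b xor s                       ∎)

  induced-fixed⇒identity : (π : Permutation′ n) → (∀ x → isLeft (π ⟨$⟩ʳ x) ≡ isLeft x) →
                           (∀ s k → k < m → induced π s k ≡ k) → IsIdentity π
  induced-fixed⇒identity π same-side fixed x = coord-injective (same-side x) (begin
    coord (π ⟨$⟩ʳ x)                           ≡⟨ cong (λ z → coord (π ⟨$⟩ʳ z)) (vertex-coord x) ⟨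
    induced π (isLeft x) (coord x)             ≡⟨ fixed (isLeft x) (coord x) (coord<m x) ⟩
    coord x                                    ∎)
    where open ≡-Reasoning

-- Permutations preserving the colouring

module Preserving {m : ℕ} (4≤m : 4 ≤ m) (σ : Permutation′ (2 * m))
                  (preserves : Preserves (Construction.colouring m) σ) where

  open Construction m

  3≤m : 3 ≤ m
  3≤m = ≤-trans (n≤1+n 3) 4≤m

  open Coordinates (<-≤-trans (s≤s z≤n) 3≤m)

  pairColour-invariant : ∀ P → ∣ P ∣ ≡ m →
                         pairColour (image σ P) (∁ (image σ P)) ≡ pairColour P (∁ P)
  pairColour-invariant P ∣P∣≡m = subst (λ Q → pairColour (image σ P) Q ≡ pairColour P (∁ P))
    (image-∁ σ P) (preserves P (∁ P) (equipartition-∁ P ∣P∣≡m))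

  Half-invariant : image σ Half ≡ Half ⊎ image σ Half ≡ ∁ Half
  Half-invariant with ⊔≡Y (trans (pairColour-invariant Half ∣Half∣) (cong (_⊔ shade (∁ Half)) shade-Half))
  ... | inj₁ σHalf-Y  = inj₁ (shade≡Y⇒≡Half σHalf-Y)
  ... | inj₂ ∁σHalf-Y = inj₂ (trans (sym (∁-involutive _)) (cong ∁ (shade≡Y⇒≡Half ∁σHalf-Y)))

  lookup-image-Half : ∀ {Q} → image σ Half ≡ Q → ∀ x → lookup Q (σ ⟨$⟩ʳ x) ≡ isLeft x
  lookup-image-Half {Q} σHalf≡Q x = begin
    lookup Q (σ ⟨$⟩ʳ x)                   ≡⟨ cong (λ P → lookup P (σ ⟨$⟩ʳ x)) σHalf≡Q ⟨
    lookup (image σ Half) (σ ⟨$⟩ʳ x)      ≡⟨ lookup-image σ Half _ ⟩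
    lookup Half (σ ⟨$⟩ˡ (σ ⟨$⟩ʳ x))        ≡⟨ cong (lookup Half) (inverseˡ σ) ⟩
    lookup Half x                         ≡⟨ lookup-Half x ⟩
    isLeft x                              ∎
    where open ≡-Reasoning

  same-colour⇒red⇔ : ∀ {c d} → c ≡ d → (c ≡ R) ⇔ (d ≡ R)
  same-colour⇒red⇔ c≡d = mk⇔ (trans (sym c≡d)) (trans c≡d)

  module HalvesFixed (σHalf : image σ Half ≡ Half) where

    isLeft-σ : ∀ x → isLeft (σ ⟨$⟩ʳ x) ≡ isLeft x
    isLeft-σ x = trans (sym (lookup-Half _)) (lookup-image-Half σHalf x)

    Edge-σ : ∀ {a b} → isLeft a ≡ true → isLeft b ≡ false → Edge a b ⇔ Edge (σ ⟨$⟩ʳ a) (σ ⟨$⟩ʳ b)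
    Edge-σ {a} {b} la rb = ⇔.trans (Edge⇔red 3≤m la rb) (⇔.trans (same-colour⇒red⇔ (sym colours))
      (⇔.sym (Edge⇔red 3≤m (trans (isLeft-σ a) la) (trans (isLeft-σ b) rb))))
      where
      image-swapped : image σ (swapped a b) ≡ swapped (σ ⟨$⟩ʳ a) (σ ⟨$⟩ʳ b)
      image-swapped = trans (image-transpose σ a b Half) (cong (image (transpose _ _)) σHalf)
      colours : pairColour (swapped (σ ⟨$⟩ʳ a) (σ ⟨$⟩ʳ b)) (∁ (swapped (σ ⟨$⟩ʳ a) (σ ⟨$⟩ʳ b)))
                ≡ pairColour (swapped a b) (∁ (swapped a b))
      colours = subst (λ P → pairColour P (∁ P) ≡ _) image-swapped
        (pairColour-invariant (swapped a b) (∣swapped∣ a b))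

    Adj-σ : ∀ {i r} → i < m → r < m → Adj i r ⇔ Adj (induced σ true i) (induced σ false r)
    Adj-σ i<m r<m = ⇔.trans (Adj⇔Edge-vertex i<m r<m)
      (⇔.trans (Edge-σ (isLeft-vertex i<m) (isLeft-vertex r<m))
        (Edge⇔Adj (trans (isLeft-σ _) (isLeft-vertex i<m)) (trans (isLeft-σ _) (isLeft-vertex r<m))))

    σ-identity : IsIdentity σ
    σ-identity = induced-fixed⇒identity σ isLeft-σ fixed
      where
      rigid : ∀ k → k < m → induced σ true k ≡ k × induced σ false k ≡ k
      rigid = adj-rigid 3≤m (induced-bijection σ false isLeft-σ true)
                            (induced-bijection σ false isLeft-σ false) Adj-σ
      fixed : ∀ s k → k < m → induced σ s k ≡ k
      fixed true  k k<m = proj₁ (rigid k k<m)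
      fixed false k k<m = proj₂ (rigid k k<m)

  module HalvesExchanged (σHalf : image σ Half ≡ ∁ Half) where

    isLeft-σ : ∀ x → isLeft (σ ⟨$⟩ʳ x) ≡ not (isLeft x)
    isLeft-σ x = not-injective (begin
      not (isLeft (σ ⟨$⟩ʳ x))             ≡⟨ cong not (lookup-Half _) ⟨
      not (lookup Half (σ ⟨$⟩ʳ x))        ≡⟨ lookup-∁ Half _ ⟨
      lookup (∁ Half) (σ ⟨$⟩ʳ x)          ≡⟨ lookup-image-Half σHalf x ⟩
      isLeft x                           ≡⟨ not-involutive _ ⟨
      not (not (isLeft x))               ∎)
      where open ≡-Reasoning

    Edge-σ : ∀ {a b} → isLeft a ≡ true → isLeft b ≡ false → Edge a b → Edge (σ ⟨$⟩ʳ b) (σ ⟨$⟩ʳ a)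
    Edge-σ {a} {b} la rb edge = Equivalence.from (Edge⇔red 3≤m (trans (isLeft-σ b) (cong not rb))
      (trans (isLeft-σ a) (cong not la))) (trans colours (Equivalence.to (Edge⇔red 3≤m la rb) edge))
      where
      open ≡-Reasoning
      S′ : Subset n
      S′ = swapped (σ ⟨$⟩ʳ b) (σ ⟨$⟩ʳ a)
      image-swapped : image σ (swapped a b) ≡ ∁ S′
      image-swapped = begin
        image σ (swapped a b)                                         ≡⟨ image-transpose σ a b Half ⟩
        image (transpose (σ ⟨$⟩ʳ a) (σ ⟨$⟩ʳ b)) (image σ Half)          ≡⟨ cong (image (transpose _ _)) σHalf ⟩
        image (transpose (σ ⟨$⟩ʳ a) (σ ⟨$⟩ʳ b)) (∁ Half)                ≡⟨ image-∁ (transpose _ _) Half ⟩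
        ∁ (swapped (σ ⟨$⟩ʳ a) (σ ⟨$⟩ʳ b))                               ≡⟨ cong ∁ (swapped-comm _ _) ⟩
        ∁ S′                                                          ∎
      colours : pairColour S′ (∁ S′) ≡ pairColour (swapped a b) (∁ (swapped a b))
      colours = begin
        pairColour S′ (∁ S′)                                          ≡⟨ ⊔-comm (shade S′) (shade (∁ S′)) ⟩
        pairColour (∁ S′) S′                                          ≡⟨ cong (pairColour (∁ S′)) (∁-involutive S′) ⟨
        pairColour (∁ S′) (∁ (∁ S′))                                   ≡⟨ cong (λ P → pairColour P (∁ P)) image-swapped ⟨
        pairColour (image σ (swapped a b)) (∁ (image σ (swapped a b))) ≡⟨ pairColour-invariant (swapped a b) (∣swapped∣ a b) ⟩
        pairColour (swapped a b) (∁ (swapped a b))                    ∎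

    Adj-σ : ∀ {i r} → i < m → r < m → Adj i r → Adj (induced σ false r) (induced σ true i)
    Adj-σ i<m r<m adj = Equivalence.to
      (Edge⇔Adj (trans (isLeft-σ _) (cong not (isLeft-vertex r<m)))
                (trans (isLeft-σ _) (cong not (isLeft-vertex i<m))))
      (Edge-σ (isLeft-vertex i<m) (isLeft-vertex r<m) (Equivalence.to (Adj⇔Edge-vertex i<m r<m) adj))

    impossible : ⊥
    impossible = no-adj-reversal 4≤m (induced-bijection σ true isLeft-σ false) Adj-σ

  σ-identity : IsIdentity σ
  σ-identity with Half-invariant
  ... | inj₁ σHalf = HalvesFixed.σ-identity σHalf
  ... | inj₂ σHalf = ⊥-elim (HalvesExchanged.impossible σHalf)

lemma3p9 : (m : ℕ) → 4 ≤ m →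
    Σ (Colouring m) (λ c → (σ : Permutation′ (2 * m)) → Preserves c σ → IsIdentity σ)
lemma3p9 m 4≤m = Construction.colouring m , λ σ preserves → Preserving.σ-identity 4≤m σ preserves
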